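{- Let $G$ be a connected graph and $r\in V(G)$ with $\mathrm{ipc}_r(G)=k$. Then for every edge $e\in E(G)$ incident to $r$, $\mathrm{ipc}_e(L(G))\le 3k+1$.
   Context: The line graph $L(G)$ has vertex set $E(G)$, two vertices adjacent iff the corresponding edges share an end-vertex. An isometric path is a shortest path; it is $x$-rooted if $x$ is one of its end-vertices. For a connected graph $F$ and $x\in V(F)$, $\mathrm{ipc}_x(F)$ is the minimum $m$ such that the vertices of every isometric path of $F$ can be covered by $m$ many $x$-rooted isometric paths of $F$. -}

module Defs where

open import Data.Nat using (ℕ; zero; suc; _≤_)
open import Data.Fin using (Fin; toℕ)
open import Data.Bool using (Bool; T)
open import Data.Product using (Σ; _×_; _,_; proj₁; proj₂; ∃)
open import Data.Sum using (_⊎_)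
open import Relation.Binary.PropositionalEquality using (_≡_; _≢_)

data Walk {V : Set} (R : V → V → Set) : V → V → Set where
  [] : ∀ {u} → Walk R u u
  _∷_ : ∀ {u w v} → R u w → Walk R w v → Walk R u v

len : ∀ {V} {R : V → V → Set} {u v} → Walk R u v → ℕ
len [] = zero
len (_ ∷ p) = suc (len p)

data _∈W_ {V : Set} {R : V → V → Set} (x : V) : ∀ {u v} → Walk R u v → Set where
  here  : ∀ {v} {p : Walk R x v} → x ∈W p
  there : ∀ {u w v} {a : R u w} {p : Walk R w v} → x ∈W p → x ∈W (a ∷ p)

Connected : {V : Set} → (V → V → Set) → Set
Connected {V} R = (u v : V) → Walk R u v

-- Isometric (shortest) path: a walk from u to v no longer than any other u-v walk.
-- (A shortest walk is automatically a path.)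
Isometric : ∀ {V} {R : V → V → Set} {u v} → Walk R u v → Set
Isometric {R = R} {u} {v} p = (q : Walk R u v) → len p ≤ len q

-- An x-rooted isometric path: an isometric path with end-vertex x
-- (oriented to start at x; paths are undirected, so this is no loss).
record RootedIso {V : Set} (R : V → V → Set) (x : V) : Set where
  constructor rooted
  field
    end  : V
    path : Walk R x end
    iso  : Isometric path

CoverableBy : {V : Set} → (V → V → Set) → V → ℕ → Set
CoverableBy {V} R x m =
  ∀ {u v} (p : Walk R u v) → Isometric p →
  Σ (Fin m → RootedIso R x) λ Q →
    ∀ y → y ∈W p → ∃ λ i → y ∈W RootedIso.path (Q i)

IpcIs : {V : Set} → (V → V → Set) → V → ℕ → Set
IpcIs R x k = CoverableBy R x k × (∀ m → m Data.Nat.< k → CoverableBy R x m → Data.Empty.⊥)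
  where import Data.Nat ; import Data.Empty

Adj : ∀ {n} → (Fin n → Fin n → Bool) → Fin n → Fin n → Set
Adj adj i j = T (adj i j)

Symmetric : ∀ {n} → (Fin n → Fin n → Bool) → Set
Symmetric {n} adj = (i j : Fin n) → adj i j ≡ adj j i

Irreflexive : ∀ {n} → (Fin n → Fin n → Bool) → Set
Irreflexive {n} adj = (i : Fin n) → adj i i ≡ Data.Bool.false
  where import Data.Bool

-- Edges of G: unordered pairs {i,j}, represented canonically with toℕ i < toℕ j.
Edge : ∀ {n} → (Fin n → Fin n → Bool) → Set
Edge {n} adj = Σ (Fin n × Fin n) λ ij →
  (toℕ (proj₁ ij) Data.Nat.< toℕ (proj₂ ij)) × Adj adj (proj₁ ij) (proj₂ ij)
  where import Data.Nat

endpoints : ∀ {n} {adj : Fin n → Fin n → Bool} → Edge adj → Fin n × Fin n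
endpoints e = proj₁ e

IncidentTo : ∀ {n} {adj : Fin n → Fin n → Bool} → Fin n → Edge adj → Set
IncidentTo x e = (x ≡ proj₁ (endpoints e)) ⊎ (x ≡ proj₂ (endpoints e))

LineAdj : ∀ {n} (adj : Fin n → Fin n → Bool) → Edge adj → Edge adj → Set
LineAdj adj e f = (endpoints e ≢ endpoints f) ×
  (Σ _ λ x → IncidentTo x e × IncidentTo x f)

-- Let d and D be the distances from r in G and from e in L(G), and for an edge g let m g be the
-- smaller d-value of its ends; then m ≤ D ≤ m + 1. Consecutive edges f t, f (t + 1) of an isometric
-- path of L(G) share a vertex s t, and the s t form an isometric path of G, covered by k r-rooted
-- isometric paths. For one of them, Q, let i and j be the first and last t with s t on Q. As d is
-- exact along Q, d (s i) and d (s j) differ by at least j − i, so m increases (or decreases) by one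
-- per step along f (i + 1), …, f j. Cutting this walk where D − m drops from 1 to 0 leaves two walks
-- along which D increases by one per step, and each of them extends a geodesic from e to an
-- e-rooted isometric path. With one path through f i this gives three per Q, and one more covers
-- the last edge.

module Submission where

open import Defs
open import Data.Nat using (ℕ; _+_; _*_)
open import Data.Fin using (Fin)
open import Data.Bool using (Bool)

open import Data.Nat using (zero; suc; _∸_; _≤_; _<_; z≤n; s≤s; _⊓_; pred; _≤?_; _<?_; anyUpTo?)
open import Data.Nat.Properties hiding (_≟_; <-cmp)
open import Data.Fin using (zero; suc; toℕ; _↑ˡ_; _↑ʳ_)
open import Data.Fin.Properties using (_≟_; any?; <-cmp)
open import Data.Bool using (T)
open import Data.Bool.Properties using (T-irrelevant)
open import Data.Product using (Σ; _×_; _,_; proj₁; proj₂; ∃)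
open import Data.Product.Properties using (≡-dec)
open import Data.Sum using (_⊎_; inj₁; inj₂; [_,_]; map₁)
open import Data.Vec.Functional as Vec using (Vector)
open import Data.Vec.Functional.Properties using (lookup-++ˡ; lookup-++ʳ)
open import Data.Vec.Functional.Relation.Unary.Any as Any using (Any)
open import Function using (_∘_)
open import Relation.Binary.PropositionalEquality hiding ([_])
open import Relation.Binary.Definitions using (DecidableEquality; tri<; tri≈; tri>)
open import Relation.Nullary using (Dec; yes; no; ¬_; contradiction)
open import Relation.Nullary.Decidable using (T?; _×-dec_; _⊎-dec_; ¬?; map′)
open import Relation.Unary using (Decidable)

slope-bound : ∀ {a x l N b} → a ≤ x → suc N ≤ l → x + l ≤ suc b → a + N ≤ b
slope-bound {a} {x} {l} {N} {b} a≤x N<l x+l≤ = ≤-pred (begin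
  suc (a + N)  ≡⟨ +-suc a N ⟨
  a + suc N    ≤⟨ +-mono-≤ a≤x N<l ⟩
  x + l        ≤⟨ x+l≤ ⟩
  suc b        ∎)
  where open ≤-Reasoning

≤-by-cases : ∀ {P : ℕ → Set} {n} → (∀ {t} → t < n → P t) → P n → ∀ {t} → t ≤ n → P t
≤-by-cases below at t≤n with m≤n⇒m<n∨m≡n t≤n
... | inj₁ t<n = below t<n
... | inj₂ refl = at

pred-≤ : ∀ N {x} → (pred N < N → pred N ≤ x) → pred N ≤ x
pred-≤ zero _ = z≤n
pred-≤ (suc N) h = h ≤-refl

module _ {P : ℕ → Set} (P? : Decidable P) where

  private
    least-below : ∀ n → (∃ λ i → P i × ∀ {t} → P t → i ≤ t) ⊎ (∀ {t} → t < n → ¬ P t)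
    least-below zero = inj₂ λ ()
    least-below (suc n) with least-below n
    ... | inj₁ least = inj₁ least
    ... | inj₂ none with P? n
    ...   | yes pn = inj₁ (n , pn , λ pt → ≮⇒≥ λ t<n → none t<n pt)
    ...   | no ¬pn = inj₂ λ t<1+n → [ none , (λ { refl → ¬pn }) ] (m<1+n⇒m<n∨m≡n t<1+n)

    greatest-below : ∀ n → (∃ λ j → P j × ∀ {t} → P t → t < n → t ≤ j) ⊎
                           (∀ {t} → t < n → ¬ P t)
    greatest-below zero = inj₂ λ ()
    greatest-below (suc n) with P? n
    ... | yes pn = inj₁ (n , pn , λ _ → ≤-pred)
    ... | no ¬pn with greatest-below n
    ...   | inj₁ (j , pj , max) =
              inj₁ (j , pj , λ pt t<1+n →
                [ max pt , (λ { refl → contradiction pt ¬pn }) ] (m<1+n⇒m<n∨m≡n t<1+n))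
    ...   | inj₂ none = inj₂ λ t<1+n → [ none , (λ { refl → ¬pn }) ] (m<1+n⇒m<n∨m≡n t<1+n)

  least : ∀ {n} → P n → ∃ λ i → P i × ∀ {t} → P t → i ≤ t
  least {n} pn with least-below (suc n)
  ... | inj₁ least = least
  ... | inj₂ none = contradiction pn (none ≤-refl)

  greatest : ∀ {n b} → (∀ {t} → P t → t < b) → P n → ∃ λ j → P j × ∀ {t} → P t → t ≤ j
  greatest {n} {b} bounded pn with greatest-below b
  ... | inj₁ (j , pj , max) = j , pj , λ pt → max pt (bounded pt)
  ... | inj₂ none = contradiction pn (none (bounded pn))

module _ {V : Set} {R : V → V → Set} where

  infixr 5 _++_
  _++_ : ∀ {u w v} → Walk R u w → Walk R w v → Walk R u v
  [] ++ q = q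
  (a ∷ p) ++ q = a ∷ (p ++ q)

  ++-assoc : ∀ {u w w′ v} (p : Walk R u w) (q : Walk R w w′) (s : Walk R w′ v) →
             (p ++ q) ++ s ≡ p ++ (q ++ s)
  ++-assoc [] q s = refl
  ++-assoc (a ∷ p) q s = cong (a ∷_) (++-assoc p q s)

  len-++ : ∀ {u w v} (p : Walk R u w) (q : Walk R w v) → len (p ++ q) ≡ len p + len q
  len-++ [] q = refl
  len-++ (a ∷ p) q = cong suc (len-++ p q)

  ∈-++⁺ˡ : ∀ {x u w v} {p : Walk R u w} (q : Walk R w v) → x ∈W p → x ∈W (p ++ q)
  ∈-++⁺ˡ q here = here
  ∈-++⁺ˡ q (there m) = there (∈-++⁺ˡ q m)

  ∈-++⁺ʳ : ∀ {x u w v} (p : Walk R u w) {q : Walk R w v} → x ∈W q → x ∈W (p ++ q)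
  ∈-++⁺ʳ [] m = m
  ∈-++⁺ʳ (a ∷ p) m = there (∈-++⁺ʳ p m)

  ∈-++⁻ : ∀ {x u w v} (p : Walk R u w) {q : Walk R w v} → x ∈W (p ++ q) → x ∈W p ⊎ x ∈W q
  ∈-++⁻ [] m = inj₂ m
  ∈-++⁻ (a ∷ p) here = inj₁ here
  ∈-++⁻ (a ∷ p) (there m) with ∈-++⁻ p m
  ... | inj₁ m′ = inj₁ (there m′)
  ... | inj₂ m′ = inj₂ m′

  ∈-∃++ : ∀ {x u v} {p : Walk R u v} → x ∈W p →
          Σ (Walk R u x) λ α → Σ (Walk R x v) λ β → p ≡ α ++ β
  ∈-∃++ {p = p} here = [] , p , refl
  ∈-∃++ (there {a = a} m) with ∈-∃++ m
  ... | α , β , eq = a ∷ α , β , cong (a ∷_) eq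

  ∈W? : DecidableEquality V → ∀ x {u v} (p : Walk R u v) → Dec (x ∈W p)
  ∈W? _≟_ x {u} p with x ≟ u
  ∈W? _≟_ x {u} p | yes refl = yes here
  ∈W? _≟_ x [] | no x≢u = no λ { here → x≢u refl }
  ∈W? _≟_ x (a ∷ p) | no x≢u with ∈W? _≟_ x p
  ... | yes m = yes (there m)
  ... | no m̸ = no λ { here → x≢u refl ; (there m) → m̸ m }

  vertex : ∀ {u v} → Walk R u v → ℕ → V
  vertex {u} [] t = u
  vertex {u} (a ∷ p) zero = u
  vertex (a ∷ p) (suc t) = vertex p t

  vertex-adjacent : ∀ {u v} (p : Walk R u v) {t} → t < len p → R (vertex p t) (vertex p (suc t))
  vertex-adjacent (a ∷ []) {zero} _ = a
  vertex-adjacent (a ∷ (b ∷ p)) {zero} _ = a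
  vertex-adjacent (a ∷ p) {suc t} (s≤s t<) = vertex-adjacent p t<

  ∈-by-position : ∀ {P : V → Set} {u v} (p : Walk R u v) →
                  (∀ {t} → t ≤ len p → P (vertex p t)) → ∀ {x} → x ∈W p → P x
  ∈-by-position [] at here = at z≤n
  ∈-by-position (a ∷ p) at here = at z≤n
  ∈-by-position (a ∷ p) at (there x∈) = ∈-by-position p (at ∘ s≤s) x∈

  take : ∀ {u v} (p : Walk R u v) t → Walk R u (vertex p t)
  take [] t = []
  take (a ∷ p) zero = []
  take (a ∷ p) (suc t) = a ∷ take p t

  len-take : ∀ {u v} (p : Walk R u v) {t} → t ≤ len p → len (take p t) ≡ t
  len-take [] z≤n = refl
  len-take (a ∷ p) z≤n = refl
  len-take (a ∷ p) (s≤s t≤) = cong suc (len-take p t≤)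

  drop : ∀ {u v} (p : Walk R u v) t → Walk R (vertex p t) v
  drop [] t = []
  drop (a ∷ p) zero = a ∷ p
  drop (a ∷ p) (suc t) = drop p t

  len-drop : ∀ {u v} (p : Walk R u v) t → len (drop p t) ≡ len p ∸ t
  len-drop [] t = sym (0∸n≡0 t)
  len-drop (a ∷ p) zero = refl
  len-drop (a ∷ p) (suc t) = len-drop p t

  isometric-segment : ∀ {u v} {p : Walk R u v} → Isometric p → ∀ {x y} → x ≤ len p → y ≤ len p →
                      (q : Walk R (vertex p x) (vertex p y)) → y ≤ x + len q
  isometric-segment {p = p} iso {x} {y} x≤ y≤ q =
    +-cancelʳ-≤ (len p ∸ y) y (x + len q) (begin
      y + (len p ∸ y)                  ≡⟨ m+[n∸m]≡n y≤ ⟩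
      len p                            ≤⟨ iso (take p x ++ q ++ drop p y) ⟩
      len (take p x ++ q ++ drop p y)  ≡⟨ len-++ (take p x) (q ++ drop p y) ⟩
      len (take p x) + len (q ++ drop p y)
        ≡⟨ cong₂ _+_ (len-take p x≤) (trans (len-++ q (drop p y)) (cong (len q +_) (len-drop p y))) ⟩
      x + (len q + (len p ∸ y))        ≡⟨ +-assoc x (len q) (len p ∸ y) ⟨
      x + len q + (len p ∸ y)          ∎)
    where open ≤-Reasoning

  tabulate : (g : ℕ → V) (d : ℕ) → (∀ {l} → l < d → R (g l) (g (suc l))) → Walk R (g 0) (g d)
  tabulate g zero adj = []
  tabulate g (suc d) adj = adj (s≤s z≤n) ∷ tabulate (λ l → g (suc l)) d (λ l< → adj (s≤s l<))

  len-tabulate : ∀ g d (adj : ∀ {l} → l < d → R (g l) (g (suc l))) → len (tabulate g d adj) ≡ d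
  len-tabulate g zero adj = refl
  len-tabulate g (suc d) adj = cong suc (len-tabulate (λ l → g (suc l)) d _)

  ∈-tabulate : ∀ g d (adj : ∀ {l} → l < d → R (g l) (g (suc l))) {l} → l ≤ d →
               g l ∈W tabulate g d adj
  ∈-tabulate g zero adj z≤n = here
  ∈-tabulate g (suc d) adj z≤n = here
  ∈-tabulate g (suc d) adj (s≤s l≤) = there (∈-tabulate (λ l → g (suc l)) d _ l≤)

  module Reverse (sym-R : ∀ {u v} → R u v → R v u) where

    reverse : ∀ {u v} → Walk R u v → Walk R v u
    reverse [] = []
    reverse (a ∷ p) = reverse p ++ (sym-R a ∷ [])

    len-reverse : ∀ {u v} (p : Walk R u v) → len (reverse p) ≡ len p
    len-reverse [] = refl
    len-reverse (a ∷ p) = begin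
      len (reverse p ++ (sym-R a ∷ []))  ≡⟨ len-++ (reverse p) (sym-R a ∷ []) ⟩
      len (reverse p) + 1                ≡⟨ +-comm (len (reverse p)) 1 ⟩
      suc (len (reverse p))              ≡⟨ cong suc (len-reverse p) ⟩
      suc (len p)                        ∎
      where open ≡-Reasoning

    ∈-reverse⁺ : ∀ {x u v} {p : Walk R u v} → x ∈W p → x ∈W reverse p
    ∈-reverse⁺ {p = []} here = here
    ∈-reverse⁺ {p = a ∷ p} here = ∈-++⁺ʳ (reverse p) (there here)
    ∈-reverse⁺ (there {a = a} m) = ∈-++⁺ˡ (sym-R a ∷ []) (∈-reverse⁺ m)

module Shortest {V : Set} (R : V → V → Set)
  (∃? : ∀ {P : V → Set} → Decidable P → Dec (∃ P))
  (R? : ∀ u v → Dec (R u v)) (_≟_ : DecidableEquality V) where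

  private
    WalkOfLength : ℕ → V → V → Set
    WalkOfLength zero u v = u ≡ v
    WalkOfLength (suc l) u v = ∃ λ w → R u w × WalkOfLength l w v

    walkOfLength? : ∀ l u v → Dec (WalkOfLength l u v)
    walkOfLength? zero u v = u ≟ v
    walkOfLength? (suc l) u v = ∃? λ w → R? u w ×-dec walkOfLength? l w v

    toWalk : ∀ l {u v} → WalkOfLength l u v → Σ (Walk R u v) λ p → len p ≡ l
    toWalk zero refl = [] , refl
    toWalk (suc l) (w , a , rest) with toWalk l rest
    ... | p , refl = a ∷ p , refl

    fromWalk : ∀ {u v} (p : Walk R u v) → WalkOfLength (len p) u v
    fromWalk [] = refl
    fromWalk (a ∷ p) = _ , a , fromWalk p

  shortest : ∀ {u v} → Walk R u v → Σ (Walk R u v) Isometric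
  shortest {u} {v} p with least (λ l → walkOfLength? l u v) (fromWalk p)
  ... | l , l-walk , minimal with toWalk l l-walk
  ...   | q , refl = q , λ q′ → minimal (fromWalk q′)

record Ascent {V : Set} (R : V → V → Set) (h : V → ℕ) (u : V) : Set where
  constructor ascent
  field
    {end}     : V
    walk      : Walk R u end
    ascending : h u + len walk ≤ h end

ascent-[] : ∀ {V : Set} {R : V → V → Set} {h : V → ℕ} {u : V} → Ascent R h u
ascent-[] {h = h} {u} = ascent [] (≤-reflexive (+-identityʳ (h u)))

module Geodesics {V : Set} (R : V → V → Set) (x : V)
  (geodesic : ∀ v → Σ (Walk R x v) Isometric) where

  geodesicTo : ∀ v → Walk R x v
  geodesicTo v = proj₁ (geodesic v)

  dist : V → ℕ
  dist v = len (geodesicTo v)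

  dist-minimal : ∀ {v} (q : Walk R x v) → dist v ≤ len q
  dist-minimal {v} = proj₂ (geodesic v)

  dist-step : ∀ {u v} → R u v → dist v ≤ suc (dist u)
  dist-step {u} a = begin
    dist _                          ≤⟨ dist-minimal (geodesicTo u ++ (a ∷ [])) ⟩
    len (geodesicTo u ++ (a ∷ []))  ≡⟨ len-++ (geodesicTo u) (a ∷ []) ⟩
    dist u + 1                      ≡⟨ +-comm (dist u) 1 ⟩
    suc (dist u)                    ∎
    where open ≤-Reasoning

  dist-prefix : ∀ {y v} (α : Walk R x y) (β : Walk R y v) → Isometric (α ++ β) → dist y ≡ len α
  dist-prefix {y} α β iso = ≤-antisym (dist-minimal α) (+-cancelʳ-≤ (len β) (len α) (dist y) (begin
    len α + len β            ≡⟨ len-++ α β ⟨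
    len (α ++ β)             ≤⟨ iso (geodesicTo y ++ β) ⟩
    len (geodesicTo y ++ β)  ≡⟨ len-++ (geodesicTo y) β ⟩
    dist y + len β           ∎))
    where open ≤-Reasoning

  extend : ∀ {u} → Ascent R dist u → RootedIso R x
  extend {u} (ascent {v} w asc) = rooted v (geodesicTo u ++ w) λ q → begin
    len (geodesicTo u ++ w)  ≡⟨ len-++ (geodesicTo u) w ⟩
    dist u + len w           ≤⟨ asc ⟩
    dist v                   ≤⟨ dist-minimal q ⟩
    len q                    ∎
    where open ≤-Reasoning

  ∈-extend : ∀ {y u} (A : Ascent R dist u) → y ∈W Ascent.walk A → y ∈W RootedIso.path (extend A)
  ∈-extend {u = u} A = ∈-++⁺ʳ (geodesicTo u)

  rootedAt : V → RootedIso R x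
  rootedAt v = extend (ascent-[] {u = v})

  ∈-rootedAt : ∀ v → v ∈W RootedIso.path (rootedAt v)
  ∈-rootedAt v = ∈-extend (ascent-[] {u = v}) here

  module _ (sym-R : ∀ {u v} → R u v → R v u) where

    open Reverse {R = R} sym-R

    walk-along : (Q : RootedIso R x) → ∀ {y z} → y ∈W RootedIso.path Q → z ∈W RootedIso.path Q →
                 Σ (Walk R y z) λ w → dist y + len w ≡ dist z ⊎ dist z + len w ≡ dist y
    walk-along (rooted _ _ iso) y∈ z∈ with ∈-∃++ y∈
    ... | α , β , refl with ∈-++⁻ α z∈
    ...   | inj₂ z∈β with ∈-∃++ z∈β
    ...     | β₁ , β₂ , refl = β₁ , inj₁ (begin
      dist _ + len β₁  ≡⟨ cong (_+ len β₁) (dist-prefix α (β₁ ++ β₂) iso) ⟩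
      len α + len β₁   ≡⟨ len-++ α β₁ ⟨
      len (α ++ β₁)
        ≡⟨ dist-prefix (α ++ β₁) β₂ (subst Isometric (sym (++-assoc α β₁ β₂)) iso) ⟨
      dist _           ∎)
      where open ≡-Reasoning
    walk-along (rooted _ _ iso) y∈ z∈ | α , β , refl | inj₁ z∈α with ∈-∃++ z∈α
    ...     | α₁ , α₂ , refl = reverse α₂ , inj₂ (begin
      dist _ + len (reverse α₂)
        ≡⟨ cong₂ _+_ (dist-prefix α₁ (α₂ ++ β) (subst Isometric (++-assoc α₁ α₂ β) iso)) (len-reverse α₂) ⟩
      len α₁ + len α₂            ≡⟨ len-++ α₁ α₂ ⟨
      len (α₁ ++ α₂)             ≡⟨ dist-prefix (α₁ ++ α₂) β iso ⟨
      dist _                     ∎)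
      where open ≡-Reasoning

module Ascents {V : Set} {R : V → V → Set} (m D : V → ℕ)
  (m-step : ∀ {u v} → R u v → m v ≤ suc (m u))
  (m≤D : ∀ v → m v ≤ D v) (D≤1+m : ∀ v → D v ≤ suc (m v)) where

  TwoAscents : ∀ {u v} → Walk R u v → Set
  TwoAscents {u} σ = Σ (Ascent R D u) λ A → ∃ λ u′ → Σ (Ascent R D u′) λ B →
                     ∀ {x} → x ∈W σ → x ∈W Ascent.walk A ⊎ x ∈W Ascent.walk B

  private
    m-walk : ∀ {u v} (σ : Walk R u v) → m v ≤ m u + len σ
    m-walk {u} [] = ≤-reflexive (sym (+-identityʳ (m u)))
    m-walk {u} (a ∷ σ) = begin
      m _                ≤⟨ m-walk σ ⟩
      m _ + len σ        ≤⟨ +-monoˡ-≤ (len σ) (m-step a) ⟩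
      suc (m u) + len σ  ≡⟨ +-suc (m u) (len σ) ⟨
      m u + len (a ∷ σ)  ∎
      where open ≤-Reasoning

    m-ascending-tail : ∀ {u u′ v} (a : R u u′) (σ : Walk R u′ v) →
                       m u + len (a ∷ σ) ≤ m v → m u′ + len σ ≤ m v
    m-ascending-tail {u} a σ asc = begin
      m _ + len σ        ≤⟨ +-monoˡ-≤ (len σ) (m-step a) ⟩
      suc (m u) + len σ  ≡⟨ +-suc (m u) (len σ) ⟨
      m u + len (a ∷ σ)  ≤⟨ asc ⟩
      m _                ∎
      where open ≤-Reasoning

    m-ascending-head : ∀ {u u′ v} (a : R u u′) (σ : Walk R u′ v) →
                       m u + len (a ∷ σ) ≤ m v → suc (m u) ≤ m u′
    m-ascending-head {u} {u′} a σ asc = +-cancelʳ-≤ (len σ) (suc (m u)) (m u′) (begin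
      suc (m u) + len σ  ≡⟨ +-suc (m u) (len σ) ⟨
      m u + len (a ∷ σ)  ≤⟨ asc ⟩
      m _                ≤⟨ m-walk σ ⟩
      m u′ + len σ       ∎)
      where open ≤-Reasoning

    low-start-ascends : ∀ {u v} (σ : Walk R u v) → D u ≤ m u → m u + len σ ≤ m v →
                        D u + len σ ≤ D v
    low-start-ascends σ low asc = ≤-trans (+-monoˡ-≤ (len σ) low) (≤-trans asc (m≤D _))

    low-or-high : ∀ u → D u ≤ m u ⊎ D u ≡ suc (m u)
    low-or-high u with D u ≤? m u
    ... | yes low = inj₁ low
    ... | no ¬low = inj₂ (≤-antisym (D≤1+m u) (≰⇒> ¬low))

    ascent-∷ : ∀ {u u′} → R u u′ → suc (D u) ≤ D u′ → Ascent R D u′ → Ascent R D u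
    ascent-∷ {u} {u′} a rise (ascent α asc) = ascent (a ∷ α) (begin
      D u + suc (len α)  ≡⟨ +-suc (D u) (len α) ⟩
      suc (D u) + len α  ≤⟨ +-monoˡ-≤ (len α) rise ⟩
      D u′ + len α       ≤⟨ asc ⟩
      D _                ∎)
      where open ≤-Reasoning

    -- The first ascent follows σ while D = m + 1; at the first vertex with D = m the second one
    -- takes over, and it keeps ascending because m does.
    high-start : ∀ {u v} (σ : Walk R u v) → D u ≡ suc (m u) → m u + len σ ≤ m v → TwoAscents σ
    high-start {u} [] _ _ = ascent-[] , u , ascent-[] , inj₁
    high-start (_∷_ {w = u′} a σ) high asc with low-or-high u′
    ... | inj₁ low′ =
      ascent-[] , u′ , ascent σ (low-start-ascends σ low′ (m-ascending-tail a σ asc)) ,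
      λ { here → inj₁ here ; (there x∈) → inj₂ x∈ }
    ... | inj₂ high′ with high-start σ high′ (m-ascending-tail a σ asc)
    ...   | A , u″ , B , cover =
      ascent-∷ a rise A , u″ , B , λ { here → inj₁ here ; (there x∈) → map₁ there (cover x∈) }
      where
        rise : suc (D _) ≤ D u′
        rise = begin
          suc (D _)        ≡⟨ cong suc high ⟩
          suc (suc (m _))  ≤⟨ s≤s (m-ascending-head a σ asc) ⟩
          suc (m u′)       ≡⟨ high′ ⟨
          D u′             ∎
          where open ≤-Reasoning

  two-ascents : ∀ {u v} (σ : Walk R u v) → m u + len σ ≤ m v → TwoAscents σ
  two-ascents {u} σ asc with low-or-high u
  ... | inj₁ low = ascent σ (low-start-ascends σ low asc) , u , ascent-[] , inj₁
  ... | inj₂ high = high-start σ high asc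

column : ∀ {A : Set} {k} → Fin 3 → (Fin k → Vector A 3) → Vector A k
column c T q = T q c

columns : ∀ {A : Set} {k} → (Fin k → Vector A 3) → Vector A (3 * k)
columns T = column zero T Vec.++ column (suc zero) T Vec.++ column (suc (suc zero)) T Vec.++ Vec.[]

module _ {A : Set} (P : A → Set) where

  Any-++⁺ˡ : ∀ {a b} (xs : Vector A a) (ys : Vector A b) → Any P xs → Any P (xs Vec.++ ys)
  Any-++⁺ˡ {b = b} xs ys (i , pi) = i ↑ˡ b , subst P (sym (lookup-++ˡ xs ys i)) pi

  Any-++⁺ʳ : ∀ {a b} (xs : Vector A a) (ys : Vector A b) → Any P ys → Any P (xs Vec.++ ys)
  Any-++⁺ʳ {a} xs ys (i , pi) = a ↑ʳ i , subst P (sym (lookup-++ʳ xs ys i)) pi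

  Any-columns : ∀ {k} (T : Fin k → Vector A 3) {q} → Any P (T q) → Any P (columns T)
  Any-columns T {q} (zero , pz) = Any-++⁺ˡ (column zero T) _ (q , pz)
  Any-columns T {q} (suc zero , po) =
    Any-++⁺ʳ (column zero T) _ (Any-++⁺ˡ (column (suc zero) T) _ (q , po))
  Any-columns T {q} (suc (suc zero) , pt) =
    Any-++⁺ʳ (column zero T) _ (Any-++⁺ʳ (column (suc zero) T) _
      (Any-++⁺ˡ (column (suc (suc zero)) T) Vec.[] (q , pt)))

module LineGraph {n : ℕ} (adj : Fin n → Fin n → Bool)
  (adj-sym : Symmetric adj) (adj-irrefl : Irreflexive adj) where

  Inc : Fin n → Edge adj → Set
  Inc x g = IncidentTo {adj = adj} x g

  Adj-sym : ∀ {a b} → Adj adj a b → Adj adj b a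
  Adj-sym {a} {b} = subst T (adj-sym a b)

  LineAdj-sym : ∀ {g h} → LineAdj adj g h → LineAdj adj h g
  LineAdj-sym (g≢h , x , x∈g , x∈h) = g≢h ∘ sym , x , x∈h , x∈g

  edge-proof-irrelevant : ∀ {a b} (pr pr′ : toℕ a < toℕ b × Adj adj a b) → pr ≡ pr′
  edge-proof-irrelevant (lt , t) (lt′ , t′) = cong₂ _,_ (<-irrelevant lt lt′) (T-irrelevant t t′)

  endpoints-injective : ∀ {g h : Edge adj} → endpoints g ≡ endpoints h → g ≡ h
  endpoints-injective {_ , pr} {_ , pr′} refl = cong (_ ,_) (edge-proof-irrelevant pr pr′)

  _≟ₑ_ : DecidableEquality (Fin n × Fin n)
  _≟ₑ_ = ≡-dec _≟_ _≟_

  _≟E_ : DecidableEquality (Edge adj)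
  g ≟E h = map′ endpoints-injective (cong endpoints) (endpoints g ≟ₑ endpoints h)

  Inc? : ∀ x g → Dec (Inc x g)
  Inc? x ((a , b) , _) = (x ≟ a) ⊎-dec (x ≟ b)

  LineAdj? : ∀ g h → Dec (LineAdj adj g h)
  LineAdj? g h = ¬? (endpoints g ≟ₑ endpoints h) ×-dec any? (λ x → Inc? x g ×-dec Inc? x h)

  any-edge? : ∀ {P : Edge adj → Set} → Decidable P → Dec (∃ P)
  any-edge? {P} P? = map′ (λ (a , b , pr , p) → ((a , b) , pr) , p)
                          (λ (((a , b) , pr) , p) → a , b , pr , p)
                          (any? λ a → any? λ b → edge-at? a b)
    where
      edge-at? : ∀ a b → Dec (Σ (toℕ a < toℕ b × Adj adj a b) λ pr → P ((a , b) , pr))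
      edge-at? a b with (toℕ a <? toℕ b) ×-dec T? (adj a b)
      ... | no ¬pr = no (¬pr ∘ proj₁)
      ... | yes pr = map′ (pr ,_)
                          (λ (pr′ , p) → subst (λ pr″ → P ((a , b) , pr″)) (edge-proof-irrelevant pr′ pr) p)
                          (P? ((a , b) , pr))

  edge-through : ∀ {a b} → Adj adj a b → Σ (Edge adj) λ g → Inc a g × Inc b g
  edge-through {a} {b} t with <-cmp a b
  ... | tri< a<b _ _ = ((a , b) , a<b , t) , inj₁ refl , inj₂ refl
  ... | tri≈ _ refl _ = contradiction (subst T (adj-irrefl a) t) λ ()
  ... | tri> _ _ b<a = ((b , a) , b<a , Adj-sym t) , inj₂ refl , inj₁ refl

  incident-adjacent : ∀ {a b g} → Inc a g → Inc b g → a ≢ b → Adj adj a b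
  incident-adjacent (inj₁ refl) (inj₁ refl) a≢b = contradiction refl a≢b
  incident-adjacent {g = _ , _ , t} (inj₁ refl) (inj₂ refl) _ = t
  incident-adjacent {g = _ , _ , t} (inj₂ refl) (inj₁ refl) _ = Adj-sym t
  incident-adjacent (inj₂ refl) (inj₂ refl) a≢b = contradiction refl a≢b

  common-walk : ∀ {x g h} → Inc x g → Inc x h → Σ (Walk (LineAdj adj) g h) λ q → len q ≤ 1
  common-walk {x} {g} {h} x∈g x∈h with endpoints g ≟ₑ endpoints h
  ... | yes eq rewrite endpoints-injective {g} {h} eq = [] , z≤n
  ... | no g≢h = (g≢h , x , x∈g , x∈h) ∷ [] , s≤s z≤n

  lift : ∀ {a b g h} (w : Walk (Adj adj) a b) → Inc a g → Inc b h →
         Σ (Walk (LineAdj adj) g h) λ q → len q ≤ suc (len w)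
  lift {g = g} {h} [] a∈g a∈h = common-walk {g = g} {h} a∈g a∈h
  lift {g = g} {h} (t ∷ w) a∈g b∈h with edge-through t
  ... | g′ , a∈g′ , c∈g′ with common-walk {g = g} {g′} a∈g a∈g′ | lift {g = g′} {h} w c∈g′ b∈h
  ...   | q₁ , q₁≤1 | q₂ , q₂≤ =
    q₁ ++ q₂ , ≤-trans (≤-reflexive (len-++ q₁ q₂)) (+-mono-≤ q₁≤1 q₂≤)

  project : ∀ {g h a} (q : Walk (LineAdj adj) g h) → Inc a g →
            ∃ λ b → Inc b h × Σ (Walk (Adj adj) a b) λ w → len w ≤ len q
  project {a = a} [] a∈g = a , a∈g , [] , z≤n
  project {g} {a = a} ((_ , x , x∈g , x∈g′) ∷ q) a∈g with project q x∈g′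
  ... | b , b∈h , w , w≤ with a ≟ x
  ...   | yes refl = b , b∈h , w , ≤-trans w≤ (n≤1+n _)
  ...   | no a≢x = b , b∈h , incident-adjacent {g = g} a∈g x∈g a≢x ∷ w , s≤s w≤

  shared : ∀ {g h} → Walk (LineAdj adj) g h → ℕ → Fin n
  shared {g} [] t = proj₁ (endpoints g)
  shared ((_ , x , _) ∷ q) zero = x
  shared (_ ∷ q) (suc t) = shared q t

  shared-incident : ∀ {g h} (q : Walk (LineAdj adj) g h) {t} → t < len q →
                    Inc (shared q t) (vertex q t) × Inc (shared q t) (vertex q (suc t))
  shared-incident ((_ , _ , x∈g , x∈g′) ∷ []) {zero} _ = x∈g , x∈g′
  shared-incident ((_ , _ , x∈g , x∈g′) ∷ (_ ∷ _)) {zero} _ = x∈g , x∈g′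
  shared-incident (_ ∷ q) {suc t} (s≤s t<) = shared-incident q t<

module LineGeodesics {n : ℕ} (adj : Fin n → Fin n → Bool)
  (adj-sym : Symmetric adj) (adj-irrefl : Irreflexive adj)
  (conn : Connected (Adj adj)) (r : Fin n) (e : Edge adj) (r∈e : IncidentTo r e) where

  open LineGraph adj adj-sym adj-irrefl

  private
    module ShortestG = Shortest (Adj adj) any? (λ u v → T? (adj u v)) _≟_
    module ShortestL = Shortest (LineAdj adj) any-edge? LineAdj? _≟E_

  -- Opaque, so that types mentioning d or D never unfold the exhaustive searches behind them.
  opaque
    geodesic-from-r : ∀ y → Σ (Walk (Adj adj) r y) Isometric
    geodesic-from-r y = ShortestG.shortest (conn r y)

    geodesic-from-e : ∀ g → Σ (Walk (LineAdj adj) e g) Isometric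
    geodesic-from-e g =
      ShortestL.shortest (proj₁ (lift {g = e} {g} (conn r (proj₁ (endpoints g))) r∈e (inj₁ refl)))

  module G = Geodesics (Adj adj) r geodesic-from-r
  module L = Geodesics (LineAdj adj) e geodesic-from-e
  open G using () renaming (dist to d)
  open L using () renaming (dist to D)

  m : Edge adj → ℕ
  m ((a , b) , _) = d a ⊓ d b

  m≤d : ∀ {x g} → Inc x g → m g ≤ d x
  m≤d {g = (a , b) , _} (inj₁ refl) = m⊓n≤m (d a) (d b)
  m≤d {g = (a , b) , _} (inj₂ refl) = m⊓n≤n (d a) (d b)

  d≤1+m : ∀ {x g} → Inc x g → d x ≤ suc (m g)
  d≤1+m {g = (a , b) , _ , t} (inj₁ refl) = ⊓-glb (n≤1+n (d a)) (G.dist-step (Adj-sym t))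
  d≤1+m {g = (a , b) , _ , t} (inj₂ refl) = ⊓-glb (G.dist-step t) (n≤1+n (d b))

  m-step : ∀ {g h} → LineAdj adj g h → m h ≤ suc (m g)
  m-step {g} {h} (_ , x , x∈g , x∈h) = ≤-trans (m≤d {g = h} x∈h) (d≤1+m {g = g} x∈g)

  m≤D : ∀ g → m g ≤ D g
  m≤D g with project (L.geodesicTo g) r∈e
  ... | b , b∈g , w , w≤ = ≤-trans (m≤d {g = g} b∈g) (≤-trans (G.dist-minimal w) w≤)

  D≤1+d : ∀ {x g} → Inc x g → D g ≤ suc (d x)
  D≤1+d {x} {g} x∈g with lift {g = e} {g} (G.geodesicTo x) r∈e x∈g
  ... | q , q≤ = ≤-trans (L.dist-minimal q) q≤

  D≤1+m : ∀ g → D g ≤ suc (m g)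
  D≤1+m g = ⊓-glb (D≤1+d {g = g} (inj₁ refl)) (D≤1+d {g = g} (inj₂ refl))

  open Ascents {R = LineAdj adj} m D (λ {g} {h} → m-step {g} {h}) m≤D D≤1+m

  Through : Edge adj → RootedIso (LineAdj adj) e → Set
  Through y P = y ∈W RootedIso.path P

  Paths : ℕ → Set
  Paths c = Vector (RootedIso (LineAdj adj) e) c

  Covered : ∀ {c} → Paths c → Edge adj → Set
  Covered Ps y = Any (Through y) Ps

  covered-by-two : ∀ {u v} {σ : Walk (LineAdj adj) u v} → TwoAscents σ →
                   Σ (Paths 2) λ Ps → ∀ {y} → y ∈W σ → Covered Ps y
  covered-by-two (A , _ , B , cover) = Ps , λ y∈ → cases (cover y∈)
    where
      Ps : Paths 2
      Ps = L.extend A Vec.∷ L.extend B Vec.∷ Vec.[]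
      cases : ∀ {y} → y ∈W Ascent.walk A ⊎ y ∈W Ascent.walk B → Covered Ps y
      cases (inj₁ y∈A) = zero , L.∈-extend A y∈A
      cases (inj₂ y∈B) = suc zero , L.∈-extend B y∈B

  module Trace {u v} (p : Walk (LineAdj adj) u v) (p-iso : Isometric p) where

    f : ℕ → Edge adj
    f = vertex p

    s : ℕ → Fin n
    s = shared p

    s-incident : ∀ {t} → t < len p → Inc (s t) (f t) × Inc (s t) (f (suc t))
    s-incident = shared-incident p

    gap : ∀ {x y} → x < len p → y < len p → (w : Walk (Adj adj) (s x) (s y)) → y ≤ x + len w
    gap {x} {y} x< y< w with lift {g = f x} {f (suc y)} w (proj₁ (s-incident x<)) (proj₂ (s-incident y<))
    ... | q , q≤ = ≤-pred (begin
      suc y              ≤⟨ isometric-segment p-iso (<⇒≤ x<) y< q ⟩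
      x + len q          ≤⟨ +-monoʳ-≤ x q≤ ⟩
      x + suc (len w)    ≡⟨ +-suc x (len w) ⟩
      suc (x + len w)    ∎)
      where open ≤-Reasoning

    s-distinct : ∀ {l} → suc l < len p → s l ≢ s (suc l)
    s-distinct {l} l< eq
      with common-walk {g = f l} {f (suc (suc l))} (proj₁ (s-incident (<⇒≤ l<)))
             (subst (λ x → Inc x (f (suc (suc l)))) (sym eq) (proj₂ (s-incident l<)))
    ... | q , q≤1 = 1+n≰n (begin
      suc (suc l)  ≤⟨ isometric-segment p-iso (≤-trans (n≤1+n l) (<⇒≤ l<)) l< q ⟩
      l + len q    ≤⟨ +-monoʳ-≤ l q≤1 ⟩
      l + 1        ≡⟨ +-comm l 1 ⟩
      suc l        ∎)
      where open ≤-Reasoning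

    s-adjacent : ∀ {l} → suc l < len p → Adj adj (s l) (s (suc l))
    s-adjacent {l} l< =
      incident-adjacent {g = f (suc l)}
        (proj₂ (s-incident (<⇒≤ l<))) (proj₁ (s-incident l<)) (s-distinct l<)

    trace : Walk (Adj adj) (s 0) (s (pred (len p)))
    trace = tabulate s (pred (len p)) λ l< → s-adjacent (pred-cancel-< l<)

    trace-isometric : Isometric trace
    trace-isometric q = subst (_≤ len q) (sym (len-tabulate s (pred (len p)) _))
      (pred-≤ (len p) λ pred< → gap (≤-trans (s≤s z≤n) pred<) pred< q)

    s∈trace : ∀ {t} → t < len p → s t ∈W trace
    s∈trace t< = ∈-tabulate s (pred (len p)) _ (<⇒≤pred t<)

    module _ (Q : RootedIso (Adj adj) r) where

      OnQ : ℕ → Set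
      OnQ t = t < len p × s t ∈W RootedIso.path Q

      OnQ? : Decidable OnQ
      OnQ? t = (t <? len p) ×-dec ∈W? _≟_ (s t) (RootedIso.path Q)

      segment-cover : ∀ {i} N → OnQ i → OnQ (N + suc i) →
                      Σ (Paths 2) λ Ps → ∀ {l} → l ≤ N → Covered Ps (f (l + suc i))
      segment-cover {i} N (i< , i∈) (j< , j∈) = along (G.walk-along Adj-sym Q i∈ j∈)
        where
          g : ℕ → Edge adj
          g l = f (l + suc i)

          step : ∀ {l} → l < N → LineAdj adj (g l) (g (suc l))
          step l< = vertex-adjacent p (<-trans (+-monoˡ-< (suc i) l<) j<)

          σ : Walk (LineAdj adj) (g 0) (g N)
          σ = tabulate g N step

          len-σ : len σ ≡ N
          len-σ = len-tabulate g N step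

          long : (w : Walk (Adj adj) (s i) (s (N + suc i))) → suc N ≤ len w
          long w = +-cancelʳ-≤ i (suc N) (len w) (begin
            suc N + i     ≡⟨ +-suc N i ⟨
            N + suc i     ≤⟨ gap i< j< w ⟩
            i + len w     ≡⟨ +-comm i (len w) ⟩
            len w + i     ∎)
            where open ≤-Reasoning

          along : (Σ (Walk (Adj adj) (s i) (s (N + suc i))) λ w →
                    d (s i) + len w ≡ d (s (N + suc i)) ⊎ d (s (N + suc i)) + len w ≡ d (s i)) →
                  Σ (Paths 2) λ Ps → ∀ {l} → l ≤ N → Covered Ps (f (l + suc i))
          along (w , inj₁ rising) = proj₁ runs , λ l≤ → proj₂ runs (∈-tabulate g N step l≤)
            where
              ascending : m (g 0) + len σ ≤ m (g N)
              ascending = subst (λ l → m (g 0) + l ≤ m (g N)) (sym len-σ) (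
                slope-bound (m≤d {g = g 0} (proj₂ (s-incident i<))) (long w)
                            (≤-trans (≤-reflexive rising) (d≤1+m {g = g N} (proj₁ (s-incident j<)))))
              runs = covered-by-two (two-ascents σ ascending)
          along (w , inj₂ falling) =
            proj₁ runs , λ l≤ → proj₂ runs (∈-reverse⁺ (∈-tabulate g N step l≤))
            where
              open Reverse (λ {g} {h} → LineAdj-sym {g} {h})
              descending : m (g N) + len (reverse σ) ≤ m (g 0)
              descending = subst (λ l → m (g N) + l ≤ m (g 0)) (sym (trans (len-reverse σ) len-σ)) (
                slope-bound (m≤d {g = g N} (proj₁ (s-incident j<))) (long w)
                            (≤-trans (≤-reflexive falling) (d≤1+m {g = g 0} (proj₂ (s-incident i<)))))
              runs = covered-by-two (two-ascents (reverse σ) descending)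

      half-open-cover : ∀ {i j} → OnQ i → OnQ j →
             Σ (Paths 2) λ Ps → ∀ {t} → i < t → t ≤ j → Covered Ps (f t)
      half-open-cover {i} {j} onᵢ onⱼ with i <? j
      ... | no j≤i = (λ _ → L.rootedAt e) , λ i<t t≤j → contradiction (<-≤-trans i<t t≤j) j≤i
      ... | yes i<j = proj₁ segment , λ {t} i<t t≤j →
              subst (Covered (proj₁ segment) ∘ f) (m∸n+n≡m i<t)
                    (proj₂ segment (∸-monoˡ-≤ (suc i) t≤j))
        where
          segment = segment-cover (j ∸ suc i) onᵢ (subst OnQ (sym (m∸n+n≡m i<j)) onⱼ)

      interval-cover : ∀ {i j} → OnQ i → OnQ j →
                       Σ (Paths 3) λ Ps → ∀ {t} → i ≤ t → t ≤ j → Covered Ps (f t)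
      interval-cover {i} {j} onᵢ onⱼ with half-open-cover onᵢ onⱼ
      ... | Ps , covered = L.rootedAt (f i) Vec.∷ Ps , cover
        where
          cover : ∀ {t} → i ≤ t → t ≤ j → Covered (L.rootedAt (f i) Vec.∷ Ps) (f t)
          cover i≤t t≤j with m≤n⇒m<n∨m≡n i≤t
          ... | inj₂ refl = zero , L.∈-rootedAt (f i)
          ... | inj₁ i<t = Any.there {P = Through (f _)} (covered i<t t≤j)

      block : Σ (Paths 3) λ Ps → ∀ {t} → OnQ t → Covered Ps (f t)
      block with anyUpTo? (λ t → ∈W? _≟_ (s t) (RootedIso.path Q)) (len p)
      ... | no none = (λ _ → L.rootedAt e) , λ {t} onₜ → contradiction (t , onₜ) none
      ... | yes (_ , on) with least OnQ? on | greatest OnQ? proj₁ on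
      ...   | i , onᵢ , i≤ | j , onⱼ , ≤j with interval-cover onᵢ onⱼ
      ...     | Ps , cover = Ps , λ onₜ → cover (i≤ onₜ) (≤j onₜ)

  coverable : ∀ {k} → CoverableBy (Adj adj) r k → CoverableBy (LineAdj adj) e (3 * k + 1)
  coverable {k} cov p p-iso = family , λ _ → ∈-by-position p (≤-by-cases inner final)
    where
      open Trace p p-iso
      Qs : Fin k → RootedIso (Adj adj) r
      Qs = proj₁ (cov trace trace-isometric)
      blocks : Fin k → Paths 3
      blocks q = proj₁ (block (Qs q))
      last : Paths 1
      last = L.rootedAt (f (len p)) Vec.∷ Vec.[]
      family : Paths (3 * k + 1)
      family = columns blocks Vec.++ last
      inner : ∀ {t} → t < len p → Covered family (f t)
      inner {t} t< = let q , s∈Q = proj₂ (cov trace trace-isometric) _ (s∈trace t<) in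
        Any-++⁺ˡ (Through (f t)) (columns blocks) last
          (Any-columns (Through (f t)) blocks (proj₂ (block (Qs q)) (t< , s∈Q)))
      final : Covered family (f (len p))
      final = Any-++⁺ʳ (Through (f (len p))) (columns blocks) last (zero , L.∈-rootedAt (f (len p)))

lemma4p9 : (n : ℕ) (adj : Fin n → Fin n → Bool) →
    Symmetric adj → Irreflexive adj → Connected (Adj adj) →
    (r : Fin n) (k : ℕ) → IpcIs (Adj adj) r k →
    (e : Edge adj) → IncidentTo r e →
    CoverableBy (LineAdj adj) e (3 * k + 1)
lemma4p9 n adj adj-sym adj-irrefl conn r k (coverable-by-k , _) e r∈e =
  LineGeodesics.coverable adj adj-sym adj-irrefl conn r e r∈e coverable-by-k
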